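{- Every sequence $\eta$ (finite or infinite) whose terms are powers of primes has a parallel embedding in the mother sequence $\mathsf{M}$; that is, there is an infinite collection $\{\mathsf{c}_0,\mathsf{c}_1,\ldots\}$ of subsequences of $\mathsf{M}$ that is pairwise formally disjoint and such that each $\mathsf{c}_j$ is, term by term, numerically equal to $\eta$.
   Context: A power of a prime means $p^e$ with $p$ prime and $e\ge1$. The mother sequence $\mathsf{M}=\langle m_0,m_1,m_2,\ldots\rangle$ is formed by listing the integers $2,3,4,5,\ldots$ in increasing order and replacing each integer $n=p_1^{e_1}\cdots p_r^{e_r}$ (primes $p_1<\cdots<p_r$, $e_i\ge1$) by the list $p_1^{e_1},\ldots,p_r^{e_r}$; thus $\mathsf{M}=\langle 2,3,2^2,5,2,3,7,2^3,3^2,2,5,11,2^2,3,13,\ldots\rangle$. Terms $m_i$ and $m_j$ are formally distinct iff $i\neq j$ (even if $m_i=m_j$ numerically). A subsequence of $\mathsf{M}$ is given by a strictly increasing sequence of indices; its formal term set is its set of indices. A collection of subsequences of $\mathsf{M}$ is pairwise formally disjoint if any two distinct members of the collection use no common index of $\mathsf{M}$. A parallel embedding of $\eta$ is an infinite pairwise formally disjoint collection of subsequences of $\mathsf{M}$ each of which is term by term numerically equal to $\eta$. -}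

module Defs where

open import Data.Nat using (ℕ; zero; suc; _+_; _^_; _<_; _≤_; _⊔_)
open import Data.Nat.Divisibility using (_∣_; _∣?_)
open import Data.Nat.Primality using (Prime; prime?)
open import Data.List using (List; []; _∷_; map; filter; upTo; concatMap; foldr)
open import Data.Fin using (Fin; toℕ)
open import Data.Product using (Σ; _×_; ∃)
open import Relation.Nullary using (¬_)
open import Relation.Nullary.Decidable using (_×-dec_)
open import Relation.Binary.PropositionalEquality using (_≡_)

IsPrimePower : ℕ → Set
IsPrimePower n = Σ ℕ λ p → Σ ℕ λ e → Prime p × 1 ≤ e × n ≡ p ^ e

-- exponent of p in n: the largest e ∈ {0,…,n} with p ^ e ∣ n
-- (for n ≥ 1 and p ≥ 2 this is the p-adic valuation of n)
val : ℕ → ℕ → ℕ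
val p n = foldr _⊔_ 0 (filter (λ e → (p ^ e) ∣? n) (upTo (suc n)))

factors : ℕ → List ℕ
factors n = map (λ p → p ^ val p n) (filter (λ p → prime? p ×-dec p ∣? n) (upTo (suc n)))

Mprefix : ℕ → List ℕ
Mprefix k = concatMap factors (map (2 +_) (upTo k))

nth : List ℕ → ℕ → ℕ
nth []       _       = 0
nth (x ∷ xs) zero    = x
nth (x ∷ xs) (suc i) = nth xs i

-- the mother sequence: m i = m_i.  Mprefix (suc i) has length ≥ i+1
-- (each integer ≥ 2 contributes at least one term), so the default 0 is never used.
m : ℕ → ℕ
m i = nth (Mprefix (suc i)) i

ParallelEmbeddingFin : (n : ℕ) → (Fin n → ℕ) → Set
ParallelEmbeddingFin n η =
  Σ (ℕ → Fin n → ℕ) λ c →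
    (∀ j (i i' : Fin n) → toℕ i < toℕ i' → c j i < c j i')
  × (∀ j (i : Fin n) → m (c j i) ≡ η i)
  × (∀ j k (i i' : Fin n) → ¬ (j ≡ k) → ¬ (c j i ≡ c k i'))

ParallelEmbedding : (ℕ → ℕ) → Set
ParallelEmbedding η =
  Σ (ℕ → ℕ → ℕ) λ c →
    (∀ j (i i' : ℕ) → i < i' → c j i < c j i')
  × (∀ j (i : ℕ) → m (c j i) ≡ η i)
  × (∀ j k (i i' : ℕ) → ¬ (j ≡ k) → ¬ (c j i ≡ c k i'))

-- Term i of copy j is read off the block of M coming from the integer
-- N j i = η i · r ^ F, where r ∈ {2, 3} is a prime not dividing η i and F ≥ 1.
-- That block is [η i, 3 ^ F] or [2 ^ F, η i], so η i sits at a slot depending only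
-- on η i.  F grows so fast in i that N j i increases with i, so each copy is a
-- subsequence of M.  Copies sharing an index of M would share N and the slot, hence
-- the term η i and, F being the r-adic valuation of N, the exponent F; but F
-- determines the copy j, since F = E (i + j) + j + 1 where E s + s < E (s + 1).
module Submission where

open import Defs
open import Data.Nat
open import Data.Nat.Properties
open import Data.Nat.Divisibility
open import Data.Nat.Primality
open import Data.Nat.Primality.Factorisation using (factorise)
open import Data.Nat.ListAction using (product)
open import Data.Nat.Tactic.RingSolver using (solve-∀)
open import Data.Fin using (Fin; toℕ; fromℕ<)
open import Data.Fin.Properties using (toℕ<n; fromℕ<-toℕ)
open import Data.List using (List; []; _∷_; [_]; _++_; length; map; filter; upTo; concatMap; foldr)
open import Data.List.Properties
  using (upTo-∷ʳ; map-++; concatMap-++; ++-identityʳ; length-++; ++-assoc; filter-++; filter-accept; filter-reject; length-map)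
open import Data.List.Membership.Propositional using (_∈_)
open import Data.List.Membership.Propositional.Properties using (∈-filter⁺; ∈-filter⁻; ∈-upTo⁺)
open import Data.List.Relation.Unary.Any using (here; there)
open import Data.List.Relation.Unary.All using (_∷_)
open import Data.Product using (_×_; ∃; _,_; proj₁; proj₂)
open import Data.Sum using (_⊎_; inj₁; inj₂; [_,_]′)
open import Data.Empty using (⊥-elim)
open import Function using (case_of_)
open import Relation.Nullary using (¬_; yes; no)
open import Relation.Nullary.Decidable using (_×-dec_; from-yes)
open import Relation.Unary using (Decidable)
open import Relation.Binary using (tri<; tri≈; tri>)
open import Relation.Binary.PropositionalEquality
  using (_≡_; _≢_; refl; sym; trans; cong; cong₂; subst; ≢-sym; module ≡-Reasoning)

private
  variable
    a b e i i′ j k k′ n n′ p q q′ s s′ t t′ x y F F′ : ℕ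

infix 4 _[_]=_

_[_]=_ : List ℕ → ℕ → ℕ → Set
xs [ t ]= x = t < length xs × nth xs t ≡ x

nth-++ˡ : ∀ (xs ys : List ℕ) {i} → i < length xs → nth (xs ++ ys) i ≡ nth xs i
nth-++ˡ (_ ∷ _)  ys {zero}  _         = refl
nth-++ˡ (_ ∷ xs) ys {suc i} (s≤s i<) = nth-++ˡ xs ys i<

nth-++ʳ : ∀ (xs ys : List ℕ) t → nth (xs ++ ys) (length xs + t) ≡ nth ys t
nth-++ʳ []       ys t = refl
nth-++ʳ (_ ∷ xs) ys t = nth-++ʳ xs ys t

foldr-⊔-lub : ∀ xs → (∀ {x} → x ∈ xs → x ≤ e) → foldr _⊔_ 0 xs ≤ e
foldr-⊔-lub []       _  = z≤n
foldr-⊔-lub (x ∷ xs) ub = ⊔-lub (ub (here refl)) (foldr-⊔-lub xs (λ x∈ → ub (there x∈)))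

foldr-⊔-upper : ∀ xs → x ∈ xs → x ≤ foldr _⊔_ 0 xs
foldr-⊔-upper (x ∷ xs) (here refl) = m≤m⊔n x _
foldr-⊔-upper (x ∷ xs) (there x∈) = ≤-trans (foldr-⊔-upper xs x∈) (m≤n⊔m x _)

module _ {P : ℕ → Set} (P? : Decidable P) where

  filter-upTo-suc : ∀ n → filter P? (upTo (suc n)) ≡ filter P? (upTo n) ++ filter P? [ n ]
  filter-upTo-suc n = trans (cong (filter P?) (sym (upTo-∷ʳ n))) (filter-++ P? (upTo n) [ n ])

  filter-upTo-accept : P n → filter P? (upTo (suc n)) ≡ filter P? (upTo n) ++ [ n ]
  filter-upTo-accept {n} Pn = trans (filter-upTo-suc n) (cong (filter P? (upTo n) ++_) (filter-accept P? Pn))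

  filter-upTo-skip : a ≤ n → (∀ {x} → a ≤ x → x < n → ¬ P x) → filter P? (upTo n) ≡ filter P? (upTo a)
  filter-upTo-skip a≤n ¬P with m≤n⇒m<n∨m≡n a≤n
  ... | inj₂ refl = refl
  filter-upTo-skip {a} {suc n} _ ¬P | inj₁ (s≤s a≤n) = begin
    filter P? (upTo (suc n))               ≡⟨ filter-upTo-suc n ⟩
    filter P? (upTo n) ++ filter P? [ n ]  ≡⟨ cong (filter P? (upTo n) ++_) (filter-reject P? (¬P a≤n ≤-refl)) ⟩
    filter P? (upTo n) ++ []               ≡⟨ ++-identityʳ _ ⟩
    filter P? (upTo n)                     ≡⟨ filter-upTo-skip a≤n (λ a≤x x<n → ¬P a≤x (m<n⇒m<1+n x<n)) ⟩
    filter P? (upTo a)                     ∎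
    where open ≡-Reasoning

  filter-upTo-pair : a < b → b < n → P a → P b → (∀ {x} → P x → x ≡ a ⊎ x ≡ b) →
                     filter P? (upTo n) ≡ a ∷ b ∷ []
  filter-upTo-pair {a} {b} {n} a<b b<n Pa Pb onlyAB = begin
    filter P? (upTo n)                      ≡⟨ filter-upTo-skip b<n above-b ⟩
    filter P? (upTo (suc b))                ≡⟨ filter-upTo-accept Pb ⟩
    filter P? (upTo b) ++ [ b ]             ≡⟨ cong (_++ [ b ]) (filter-upTo-skip a<b between) ⟩
    filter P? (upTo (suc a)) ++ [ b ]       ≡⟨ cong (_++ [ b ]) (filter-upTo-accept Pa) ⟩
    (filter P? (upTo a) ++ [ a ]) ++ [ b ]  ≡⟨ cong (λ l → (l ++ [ a ]) ++ [ b ]) (filter-upTo-skip z≤n below-a) ⟩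
    a ∷ b ∷ []                              ∎
    where
    open ≡-Reasoning
    outside : ∀ {x} → x ≢ a → x ≢ b → ¬ P x
    outside x≢a x≢b Px = [ x≢a , x≢b ]′ (onlyAB Px)
    above-b : ∀ {x} → b < x → x < n → ¬ P x
    above-b b<x _ = outside (≢-sym (<⇒≢ (<-trans a<b b<x))) (≢-sym (<⇒≢ b<x))
    between : ∀ {x} → a < x → x < b → ¬ P x
    between a<x x<b = outside (≢-sym (<⇒≢ a<x)) (<⇒≢ x<b)
    below-a : ∀ {x} → 0 ≤ x → x < a → ¬ P x
    below-a _ x<a = outside (<⇒≢ x<a) (<⇒≢ (<-trans x<a a<b))

n<m^n : 2 ≤ a → ∀ n → n < a ^ n
n<m^n 2≤a zero    = s≤s z≤n
n<m^n {a} 2≤a (suc n) = begin-strict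
  suc n          ≤⟨ n<m^n 2≤a n ⟩
  a ^ n          <⟨ m<m+n (a ^ n) (≤-<-trans z≤n (n<m^n 2≤a n)) ⟩
  a ^ n + a ^ n  ≡⟨ cong (a ^ n +_) (+-identityʳ (a ^ n)) ⟨
  2 * a ^ n      ≤⟨ *-monoˡ-≤ (a ^ n) 2≤a ⟩
  a * a ^ n      ∎
  where open ≤-Reasoning

<-from-step : (f : ℕ → ℕ) → (∀ i → f i < f (suc i)) → s < s′ → f s < f s′
<-from-step f step s<s′ = go (<⇒<′ s<s′)
  where
  go : ∀ {s s′} → s <′ s′ → f s < f s′
  go <′-base         = step _
  go (<′-step s<′s′) = <-trans (go s<′s′) (step _)

-- Prime-power factor lists

prime≥2 : Prime p → 2 ≤ p
prime≥2 {p} p-prime = nonTrivial⇒n>1 p {{prime⇒nonTrivial p-prime}}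

prime∣^⇒≡ : Prime q → Prime p → ∀ e → q ∣ p ^ e → q ≡ p
prime∣^⇒≡ q-prime p-prime zero q∣1 = ⊥-elim (nonTrivial⇒≢1 {{prime⇒nonTrivial q-prime}} (∣1⇒≡1 q∣1))
prime∣^⇒≡ {q} {p} q-prime p-prime (suc e) q∣p^1+e with euclidsLemma p (p ^ e) q-prime q∣p^1+e
... | inj₂ q∣p^e = prime∣^⇒≡ q-prime p-prime e q∣p^e
... | inj₁ q∣p with prime⇒irreducible p-prime q∣p
...   | inj₁ refl = ⊥-elim (nonTrivial⇒≢1 {{prime⇒nonTrivial q-prime}} refl)
...   | inj₂ q≡p  = q≡p

m∣m^n : 1 ≤ e → p ∣ p ^ e
m∣m^n {suc e} {p} _ = m∣m*n (p ^ e)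

val-^* : Prime p → 1 ≤ a → ¬ p ∣ a → ∀ e → val p (p ^ e * a) ≡ e
val-^* {p} {a} p-prime 1≤a p∤a e =
  ≤-antisym (foldr-⊔-lub exps (λ x∈ → bounded (divides-of x∈))) (foldr-⊔-upper exps e∈exps)
  where
  instance
    _ = prime⇒nonZero p-prime
    _ = >-nonZero 1≤a
    _ = m^n≢0 p e
  exps : List ℕ
  exps = filter (λ x → p ^ x ∣? p ^ e * a) (upTo (suc (p ^ e * a)))
  divides-of : ∀ {x} → x ∈ exps → p ^ x ∣ p ^ e * a
  divides-of x∈ = proj₂ (∈-filter⁻ (λ x → p ^ x ∣? p ^ e * a) {xs = upTo (suc (p ^ e * a))} x∈)
  e∈exps : e ∈ exps
  e∈exps = ∈-filter⁺ (λ x → p ^ x ∣? p ^ e * a)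
             (∈-upTo⁺ (s≤s (≤-trans (<⇒≤ (n<m^n (prime≥2 p-prime) e)) (m≤m*n (p ^ e) a))))
             (m∣m*n a)
  bounded : ∀ {x} → p ^ x ∣ p ^ e * a → x ≤ e
  bounded {x} p^x∣ with x ≤? e
  ... | yes x≤e = x≤e
  ... | no  x≰e = ⊥-elim (p∤a (*-cancelˡ-∣ (p ^ e) p^e*p∣p^e*a))
    where
    p^1+e∣p^x : p ^ suc e ∣ p ^ x
    p^1+e∣p^x = divides (p ^ (x ∸ suc e)) (begin
      p ^ x                       ≡⟨ cong (p ^_) (m+[n∸m]≡n (≰⇒> x≰e)) ⟨
      p ^ (suc e + (x ∸ suc e))   ≡⟨ ^-distribˡ-+-* p (suc e) (x ∸ suc e) ⟩
      p ^ suc e * p ^ (x ∸ suc e) ≡⟨ *-comm (p ^ suc e) _ ⟩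
      p ^ (x ∸ suc e) * p ^ suc e ∎)
      where open ≡-Reasoning
    p^e*p∣p^e*a : p ^ e * p ∣ p ^ e * a
    p^e*p∣p^e*a = subst (_∣ p ^ e * a) (*-comm p (p ^ e)) (∣-trans p^1+e∣p^x p^x∣)

factors-^*^ : Prime a → Prime b → a < b → 1 ≤ x → 1 ≤ y → factors (a ^ x * b ^ y) ≡ a ^ x ∷ b ^ y ∷ []
factors-^*^ {a} {b} {x} {y} a-prime b-prime a<b 1≤x 1≤y = begin
  map (λ p → p ^ val p N) (filter P? (upTo (suc N)))
    ≡⟨ cong (map (λ p → p ^ val p N)) (filter-upTo-pair P? a<b (s≤s b≤N) (a-prime , a∣N) (b-prime , b∣N) onlyAB) ⟩
  a ^ val a N ∷ b ^ val b N ∷ []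
    ≡⟨ cong₂ (λ u v → a ^ u ∷ b ^ v ∷ []) val-a val-b ⟩
  a ^ x ∷ b ^ y ∷ [] ∎
  where
  open ≡-Reasoning
  instance
    _ = prime⇒nonZero a-prime
    _ = prime⇒nonZero b-prime
    _ = m^n≢0 a x
    _ = m^n≢0 b y
  N = a ^ x * b ^ y
  P? = λ p → prime? p ×-dec p ∣? N
  a≢b : a ≢ b
  a≢b = <⇒≢ a<b
  a∣N : a ∣ N
  a∣N = ∣-trans (m∣m^n 1≤x) (m∣m*n (b ^ y))
  b∣N : b ∣ N
  b∣N = ∣-trans (m∣m^n 1≤y) (n∣m*n (a ^ x))
  b≤N : b ≤ N
  b≤N = ∣⇒≤ {{m*n≢0 (a ^ x) (b ^ y)}} b∣N
  onlyAB : ∀ {p} → Prime p × p ∣ N → p ≡ a ⊎ p ≡ b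
  onlyAB (p-prime , p∣N) with euclidsLemma (a ^ x) (b ^ y) p-prime p∣N
  ... | inj₁ p∣a^x = inj₁ (prime∣^⇒≡ p-prime a-prime x p∣a^x)
  ... | inj₂ p∣b^y = inj₂ (prime∣^⇒≡ p-prime b-prime y p∣b^y)
  val-a : val a N ≡ x
  val-a = val-^* a-prime (m^n>0 b y) (λ a∣b^y → a≢b (prime∣^⇒≡ a-prime b-prime y a∣b^y)) x
  val-b : val b N ≡ y
  val-b = trans (cong (val b) (*-comm (a ^ x) (b ^ y)))
                (val-^* b-prime (m^n>0 a x) (λ b∣a^x → a≢b (sym (prime∣^⇒≡ b-prime a-prime x b∣a^x))) y)

length-factors>0 : 2 ≤ n → 0 < length (factors n)
length-factors>0 {n} 2≤n with factorise n {{>-nonZero (<-trans (s≤s z≤n) 2≤n)}}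
... | record { factors = [] ; isFactorisation = n≡1 } = ⊥-elim (<⇒≢ 2≤n (sym n≡1))
... | record { factors = p ∷ ps ; isFactorisation = n≡p*ps ; factorsPrime = p-prime ∷ _ } =
  subst (0 <_) (sym (length-map _ (filter P? (upTo (suc n)))))
        (nonempty (∈-filter⁺ P? (∈-upTo⁺ (s≤s (∣⇒≤ {{>-nonZero (<-trans (s≤s z≤n) 2≤n)}} p∣n))) (p-prime , p∣n)))
  where
  P? = λ p → prime? p ×-dec p ∣? n
  p∣n : p ∣ n
  p∣n = subst (p ∣_) (sym n≡p*ps) (m∣m*n (product ps))
  nonempty : ∀ {xs : List ℕ} → p ∈ xs → 0 < length xs
  nonempty {_ ∷ _} _ = s≤s z≤n

-- The mother sequence

Mprefix-suc : ∀ k → Mprefix (suc k) ≡ Mprefix k ++ factors (2 + k)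
Mprefix-suc k = begin
  concatMap factors (map (2 +_) (upTo (suc k)))              ≡⟨ cong (λ l → concatMap factors (map (2 +_) l)) (upTo-∷ʳ k) ⟨
  concatMap factors (map (2 +_) (upTo k ++ [ k ]))           ≡⟨ cong (concatMap factors) (map-++ (2 +_) (upTo k) [ k ]) ⟩
  concatMap factors (map (2 +_) (upTo k) ++ [ 2 + k ])       ≡⟨ concatMap-++ factors (map (2 +_) (upTo k)) [ 2 + k ] ⟩
  Mprefix k ++ (factors (2 + k) ++ [])                       ≡⟨ cong (Mprefix k ++_) (++-identityʳ _) ⟩
  Mprefix k ++ factors (2 + k)                               ∎
  where open ≡-Reasoning

length-Mprefix-suc : ∀ k → length (Mprefix (suc k)) ≡ length (Mprefix k) + length (factors (2 + k))
length-Mprefix-suc k = trans (cong length (Mprefix-suc k)) (length-++ (Mprefix k))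

Mprefix-prefix : k ≤ k′ → ∃ λ ys → Mprefix k′ ≡ Mprefix k ++ ys
Mprefix-prefix k≤k′ = go (≤⇒≤′ k≤k′)
  where
  go : ∀ {k k′} → k ≤′ k′ → ∃ λ ys → Mprefix k′ ≡ Mprefix k ++ ys
  go ≤′-refl = [] , sym (++-identityʳ _)
  go {k} (≤′-step {k′} k≤′k′) with go k≤′k′
  ... | ys , eq = ys ++ factors (2 + k′) , (begin
    Mprefix (suc k′)                         ≡⟨ Mprefix-suc k′ ⟩
    Mprefix k′ ++ factors (2 + k′)           ≡⟨ cong (_++ factors (2 + k′)) eq ⟩
    (Mprefix k ++ ys) ++ factors (2 + k′)    ≡⟨ ++-assoc (Mprefix k) ys _ ⟩
    Mprefix k ++ ys ++ factors (2 + k′)      ∎)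
    where open ≡-Reasoning

length-Mprefix-mono : k ≤ k′ → length (Mprefix k) ≤ length (Mprefix k′)
length-Mprefix-mono {k} k≤k′ with Mprefix-prefix k≤k′
... | ys , eq = subst (length (Mprefix k) ≤_) (sym (trans (cong length eq) (length-++ (Mprefix k)))) (m≤m+n _ _)

k≤length-Mprefix : ∀ k → k ≤ length (Mprefix k)
k≤length-Mprefix zero    = z≤n
k≤length-Mprefix (suc k) = begin
  suc k                                          ≡⟨ +-comm 1 k ⟩
  k + 1                                          ≤⟨ +-mono-≤ (k≤length-Mprefix k) (length-factors>0 {2 + k} (s≤s (s≤s z≤n))) ⟩
  length (Mprefix k) + length (factors (2 + k))  ≡⟨ length-Mprefix-suc k ⟨
  length (Mprefix (suc k))                       ∎
  where open ≤-Reasoning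

nth-Mprefix-mono : k ≤ k′ → ∀ {i} → i < length (Mprefix k) → nth (Mprefix k′) i ≡ nth (Mprefix k) i
nth-Mprefix-mono {k} {k′} k≤k′ i< with Mprefix-prefix k≤k′
... | ys , eq = trans (cong (λ l → nth l _) eq) (nth-++ˡ (Mprefix k) ys i<)

m-Mprefix : ∀ {i} → i < length (Mprefix k) → m i ≡ nth (Mprefix k) i
m-Mprefix {k} {i} i< with ≤-total (suc i) k
... | inj₁ 1+i≤k = sym (nth-Mprefix-mono 1+i≤k (k≤length-Mprefix (suc i)))
... | inj₂ k≤1+i = nth-Mprefix-mono k≤1+i i<

-- The terms coming from the integer n ≥ 2 are m (offset n + t), t < length (factors n).
offset : ℕ → ℕ
offset n = length (Mprefix (n ∸ 2))

offset+<offset-suc : ∀ k → t < length (factors (2 + k)) → offset (2 + k) + t < offset (3 + k)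
offset+<offset-suc {t} k t< = subst (offset (2 + k) + t <_) (sym (length-Mprefix-suc k)) (+-monoʳ-< (offset (2 + k)) t<)

m-offset : 2 ≤ n → factors n [ t ]= x → m (offset n + t) ≡ x
m-offset {n = suc (suc k)} {t} {x} _ (t< , nth≡x) = begin
  m (offset (2 + k) + t)                                 ≡⟨ m-Mprefix {suc k} (offset+<offset-suc k t<) ⟩
  nth (Mprefix (suc k)) (offset (2 + k) + t)             ≡⟨ cong (λ l → nth l (offset (2 + k) + t)) (Mprefix-suc k) ⟩
  nth (Mprefix k ++ factors (2 + k)) (offset (2 + k) + t) ≡⟨ nth-++ʳ (Mprefix k) (factors (2 + k)) t ⟩
  nth (factors (2 + k)) t                                ≡⟨ nth≡x ⟩
  x                                                      ∎
  where open ≡-Reasoning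

offset-< : 2 ≤ n → n < n′ → t < length (factors n) → offset n + t < offset n′ + t′
offset-< {n = suc (suc k)} {n′ = suc (suc k′)} {t} {t′} _ (s≤s (s≤s k<k′)) t< = begin-strict
  offset (2 + k) + t  <⟨ offset+<offset-suc k t< ⟩
  offset (3 + k)      ≤⟨ length-Mprefix-mono k<k′ ⟩
  offset (2 + k′)     ≤⟨ m≤m+n _ t′ ⟩
  offset (2 + k′) + t′ ∎
  where open ≤-Reasoning

offset-injective : 2 ≤ n → 2 ≤ n′ → t < length (factors n) → t′ < length (factors n′) →
                   offset n + t ≡ offset n′ + t′ → n ≡ n′ × t ≡ t′
offset-injective {n} {n′} 2≤n 2≤n′ t< t′< eq with <-cmp n n′
... | tri< n<n′ _ _ = ⊥-elim (<⇒≢ (offset-< 2≤n n<n′ t<) eq)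
... | tri> _ _ n′<n = ⊥-elim (<⇒≢ (offset-< 2≤n′ n′<n t′<) (sym eq))
... | tri≈ _ refl _ = refl , +-cancelˡ-≡ (offset n) _ _ eq

-- Padding a prime power

partner : ℕ → ℕ
partner q with 2 ∣? q
... | yes _ = 3
... | no  _ = 2

slot : ℕ → ℕ
slot q with 2 ∣? q
... | yes _ = 0
... | no  _ = 1

pad : ℕ → ℕ → ℕ
pad q F = q * partner q ^ F

prime[3] : Prime 3
prime[3] = from-yes (prime? 3)

2≤partner : ∀ q → 2 ≤ partner q
2≤partner q with 2 ∣? q
... | yes _ = s≤s (s≤s z≤n)
... | no  _ = s≤s (s≤s z≤n)

partner≤3 : ∀ q → partner q ≤ 3
partner≤3 q with 2 ∣? q
... | yes _ = ≤-refl
... | no  _ = s≤s (s≤s z≤n)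

partner-prime : ∀ q → Prime (partner q)
partner-prime q with 2 ∣? q
... | yes _ = prime[3]
... | no  _ = prime[2]

partner∤ : IsPrimePower q → ¬ partner q ∣ q
partner∤ (p , e , p-prime , _ , refl) with 2 ∣? p ^ e
... | no  2∤q = 2∤q
... | yes 2∣q with prime∣^⇒≡ prime[2] p-prime e 2∣q
...   | refl = λ 3∣2^e → case (prime∣^⇒≡ prime[3] prime[2] e 3∣2^e) of λ ()

factors-pad : IsPrimePower q → 1 ≤ F → factors (pad q F) [ slot q ]= q
factors-pad {F = F} (p , e , p-prime , 1≤e , refl) 1≤F with 2 ∣? p ^ e
... | yes 2∣q with prime∣^⇒≡ prime[2] p-prime e 2∣q
...   | refl = subst (λ l → l [ 0 ]= 2 ^ e) (sym (factors-^*^ prime[2] prime[3] ≤-refl 1≤e 1≤F)) (s≤s z≤n , refl)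
factors-pad {F = F} (p , e , p-prime , 1≤e , refl) 1≤F | no 2∤q =
  subst (λ l → l [ 1 ]= p ^ e) (sym factors≡) (s≤s (s≤s z≤n) , refl)
  where
  2<p : 2 < p
  2<p with m≤n⇒m<n∨m≡n (prime≥2 p-prime)
  ... | inj₁ 2<p  = 2<p
  ... | inj₂ refl = ⊥-elim (2∤q (m∣m^n 1≤e))
  factors≡ : factors (p ^ e * 2 ^ F) ≡ 2 ^ F ∷ p ^ e ∷ []
  factors≡ = trans (cong factors (*-comm (p ^ e) (2 ^ F))) (factors-^*^ prime[2] p-prime 2<p 1≤F 1≤e)

primePower>0 : IsPrimePower q → 0 < q
primePower>0 (p , e , p-prime , _ , refl) = m^n>0 p {{prime⇒nonZero p-prime}} e

val-pad : IsPrimePower q → ∀ F → val (partner q) (pad q F) ≡ F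
val-pad {q} q-pp F = trans (cong (val (partner q)) (*-comm q (partner q ^ F)))
                           (val-^* (partner-prime q) (primePower>0 q-pp) (partner∤ q-pp) F)

2≤pad : 0 < q → 1 ≤ F → 2 ≤ pad q F
2≤pad {q} {suc F} 0<q _ = begin
  2                          ≤⟨ 2≤partner q ⟩
  partner q                  ≤⟨ m≤m*n (partner q) (partner q ^ F) ⟩
  partner q ^ suc F          ≤⟨ m≤n*m (partner q ^ suc F) q ⟩
  q * partner q ^ suc F      ∎
  where
  open ≤-Reasoning
  instance
    _ = >-nonZero 0<q
    _ = m^n≢0 (partner q) F {{>-nonZero (≤-trans (s≤s z≤n) (2≤partner q))}}

pad-< : 0 < q′ → q + 2 * F ≤ F′ → pad q F < pad q′ F′
pad-< {q′} {q} {F} {F′} 0<q′ q+2F≤F′ = begin-strict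
  q * partner q ^ F      ≤⟨ *-monoʳ-≤ q (^-monoˡ-≤ F (partner≤3 q)) ⟩
  q * 3 ^ F              <⟨ *-monoˡ-< (3 ^ F) (n<m^n ≤-refl q) ⟩
  2 ^ q * 3 ^ F          ≤⟨ *-monoʳ-≤ (2 ^ q) (^-monoˡ-≤ F (n≤1+n 3)) ⟩
  2 ^ q * 4 ^ F          ≡⟨ cong (2 ^ q *_) (^-*-assoc 2 2 F) ⟩
  2 ^ q * 2 ^ (2 * F)    ≡⟨ ^-distribˡ-+-* 2 q (2 * F) ⟨
  2 ^ (q + 2 * F)        ≤⟨ ^-monoʳ-≤ 2 q+2F≤F′ ⟩
  2 ^ F′                 ≤⟨ ^-monoˡ-≤ F′ (2≤partner q′) ⟩
  partner q′ ^ F′        ≤⟨ m≤n*m (partner q′ ^ F′) q′ ⟩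
  q′ * partner q′ ^ F′   ∎
  where
  open ≤-Reasoning
  instance
    _ = >-nonZero 0<q′
    _ = m^n≢0 3 F

-- Parallel embeddings

module Staircase (E : ℕ → ℕ) (E-step : ∀ s → E s + s < E (suc s)) where

  E+<E : s < s′ → E s + s < E s′
  E+<E s<s′ = go (<⇒<′ s<s′)
    where
    go : ∀ {s s′} → s <′ s′ → E s + s < E s′
    go <′-base         = E-step _
    go (<′-step s<′s′) = <-trans (go s<′s′) (≤-<-trans (m≤m+n _ _) (E-step _))

  staircase-injective : j ≤ s → k ≤ s′ → E s + j ≡ E s′ + k → j ≡ k
  staircase-injective {j} {s} {k} {s′} j≤s k≤s′ eq with <-cmp s s′
  ... | tri< s<s′ _ _ = ⊥-elim (<⇒≢ (<-≤-trans (≤-<-trans (+-monoʳ-≤ (E s) j≤s) (E+<E s<s′)) (m≤m+n _ k)) eq)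
  ... | tri> _ _ s′<s = ⊥-elim (<⇒≢ (<-≤-trans (≤-<-trans (+-monoʳ-≤ (E s′) k≤s′) (E+<E s′<s)) (m≤m+n _ j)) (sym eq))
  ... | tri≈ _ refl _ = +-cancelˡ-≡ (E s) j k eq

module Embedding (η : ℕ → ℕ) (η-pp : ∀ i → IsPrimePower (η i)) where

  -- E s bounds η on [0, s], which is what exponent-growth needs.
  E : ℕ → ℕ
  E zero    = η 0
  E (suc s) = 3 * E s + s + 1 + η (suc s)

  E-step : ∀ s → E s + s < E (suc s)
  E-step s = begin-strict
    E s + s                   ≤⟨ +-monoˡ-≤ s (m≤n*m (E s) 3) ⟩
    3 * E s + s               <⟨ m<m+n _ (s≤s z≤n) ⟩
    3 * E s + s + 1           ≤⟨ m≤m+n _ (η (suc s)) ⟩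
    E (suc s)                 ∎
    where open ≤-Reasoning

  η≤E : i ≤ s → η i ≤ E s
  η≤E {s = zero} z≤n = ≤-refl
  η≤E {i} {suc s} i≤1+s with m≤n⇒m<n∨m≡n i≤1+s
  ... | inj₂ refl       = m≤n+m (η (suc s)) _
  ... | inj₁ (s≤s i≤s) = ≤-trans (η≤E i≤s) (≤-trans (m≤m+n (E s) s) (<⇒≤ (E-step s)))

  open Staircase E E-step

  exponent : ℕ → ℕ → ℕ
  exponent j i = suc (E (i + j) + j)

  exponent-injective : ∀ j i k i′ → exponent j i ≡ exponent k i′ → j ≡ k
  exponent-injective j i k i′ eq = staircase-injective (m≤n+m j i) (m≤n+m k i′) (suc-injective eq)

  exponent-growth : ∀ j i → η i + 2 * exponent j i ≤ exponent j (suc i)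
  exponent-growth j i = begin
    η i + 2 * suc (E (i + j) + j)        ≤⟨ +-monoˡ-≤ _ (η≤E (m≤m+n i j)) ⟩
    E (i + j) + 2 * suc (E (i + j) + j)  ≡⟨ regroup (E (i + j)) j ⟩
    suc (3 * E (i + j) + j + 1 + j)      ≤⟨ s≤s (+-monoˡ-≤ j 3E+j+1≤E[1+i+j]) ⟩
    suc (E (suc i + j) + j)              ∎
    where
    open ≤-Reasoning
    regroup : ∀ A J → A + 2 * suc (A + J) ≡ suc (3 * A + J + 1 + J)
    regroup = solve-∀
    3E+j+1≤E[1+i+j] : 3 * E (i + j) + j + 1 ≤ E (suc i + j)
    3E+j+1≤E[1+i+j] = ≤-trans (+-monoˡ-≤ 1 (+-monoʳ-≤ _ (m≤n+m j i))) (m≤m+n _ _)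

  N : ℕ → ℕ → ℕ
  N j i = pad (η i) (exponent j i)

  2≤N : ∀ j i → 2 ≤ N j i
  2≤N j i = 2≤pad {F = exponent j i} (primePower>0 (η-pp i)) (s≤s z≤n)

  N-increasing : ∀ j → i < i′ → N j i < N j i′
  N-increasing j = <-from-step (N j) λ i →
    pad-< {q = η i} {F = exponent j i} (primePower>0 (η-pp (suc i))) (exponent-growth j i)

  factors-N : ∀ j i → factors (N j i) [ slot (η i) ]= η i
  factors-N j i = factors-pad {F = exponent j i} (η-pp i) (s≤s z≤n)

  copy : ℕ → ℕ → ℕ
  copy j i = offset (N j i) + slot (η i)

  copy-increasing : ∀ j → i < i′ → copy j i < copy j i′
  copy-increasing {i} j i<i′ = offset-< (2≤N j i) (N-increasing j i<i′) (proj₁ (factors-N j i))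

  m∘copy : ∀ j i → m (copy j i) ≡ η i
  m∘copy j i = m-offset (2≤N j i) (factors-N j i)

  copy-injective : ∀ j k i i′ → copy j i ≡ copy k i′ → j ≡ k
  copy-injective j k i i′ eq
    with offset-injective (2≤N j i) (2≤N k i′) (proj₁ (factors-N j i)) (proj₁ (factors-N k i′)) eq
  ... | N≡ , slot≡ = exponent-injective j i k i′ (begin
    exponent j i                       ≡⟨ val-pad (η-pp i) (exponent j i) ⟨
    val (partner (η i)) (N j i)        ≡⟨ cong₂ val (cong partner η≡) N≡ ⟩
    val (partner (η i′)) (N k i′)      ≡⟨ val-pad (η-pp i′) (exponent k i′) ⟩
    exponent k i′                      ∎)
    where
    open ≡-Reasoning
    η≡ : η i ≡ η i′
    η≡ = begin
      η i                                  ≡⟨ proj₂ (factors-N j i) ⟨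
      nth (factors (N j i)) (slot (η i))   ≡⟨ cong₂ (λ n t → nth (factors n) t) N≡ slot≡ ⟩
      nth (factors (N k i′)) (slot (η i′)) ≡⟨ proj₂ (factors-N k i′) ⟩
      η i′                                 ∎

  parallelEmbedding : ParallelEmbedding η
  parallelEmbedding = copy , (λ j _ _ → copy-increasing j) , m∘copy ,
                      (λ j k i i′ j≢k eq → j≢k (copy-injective j k i i′ eq))

extend : ∀ n → (Fin n → ℕ) → ℕ → ℕ
extend n η k with k <? n
... | yes k<n = η (fromℕ< k<n)
... | no  _   = 2

extend-toℕ : ∀ {n} (η : Fin n → ℕ) (i : Fin n) → extend n η (toℕ i) ≡ η i
extend-toℕ {n} η i with toℕ i <? n
... | yes i<n = cong η (fromℕ<-toℕ i i<n)
... | no  i≮n = ⊥-elim (i≮n (toℕ<n i))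

extend-primePower : ∀ {n} {η : Fin n → ℕ} → (∀ i → IsPrimePower (η i)) → ∀ k → IsPrimePower (extend n η k)
extend-primePower {n} η-pp k with k <? n
... | yes k<n = η-pp (fromℕ< k<n)
... | no  _   = 2 , 1 , prime[2] , ≤-refl , refl

parallelEmbedding-restrict : ∀ {n} {η : Fin n → ℕ} (η′ : ℕ → ℕ) → (∀ i → η′ (toℕ i) ≡ η i) →
           ParallelEmbedding η′ → ParallelEmbeddingFin n η
parallelEmbedding-restrict η′ η′≡η (c , increasing , numeric , disjoint) =
  (λ j i → c j (toℕ i)) ,
  (λ j i i′ → increasing j (toℕ i) (toℕ i′)) ,
  (λ j i → trans (numeric j (toℕ i)) (η′≡η i)) ,
  (λ j k i i′ → disjoint j k (toℕ i) (toℕ i′))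

theorem2 : ((n : ℕ) (η : Fin n → ℕ) → (∀ i → IsPrimePower (η i)) → ParallelEmbeddingFin n η)
    × ((η : ℕ → ℕ) → (∀ i → IsPrimePower (η i)) → ParallelEmbedding η)
theorem2 =
  (λ n η η-pp → parallelEmbedding-restrict (extend n η) (extend-toℕ η)
                   (Embedding.parallelEmbedding (extend n η) (extend-primePower η-pp))) ,
  Embedding.parallelEmbedding
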